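{- Let $G_{\mathrm{inv}}=(\{x,y\},\{x_j\mapsto q^jy_jx_{j+1},\ y_j\mapsto q^jy_jx_{j+1}\},\mathrm{AIO})$, let $D$ be its $q$-derivative and $\phi$ the evaluation $\phi(x_j)=x$, $\phi(y_j)=y$. Then for every $n\ge1$, $$\phi\big(D^n(x_0)\big)=A^{\mathrm{inv}}_n(q;x,y)=\sum_{\sigma\in\mathfrak{S}_n}q^{\mathrm{inv}(\sigma)}x^{\mathrm{asc}(\sigma)}y^{\mathrm{des}(\sigma)}.$$
   Context: $\mathbb{K}$ is a commutative ring with unity of characteristic zero, $q$ an indeterminate. Variables $x_i,y_i$ ($i\ge0$) form $\mathbb{S}$; $\mathbb{E}=\mathbb{K}[q][F(\mathbb{S})]$ is the group algebra of the free group on $\mathbb{S}$. The rule $R(x_j)=q^jy_jx_{j+1}$, $R(y_j)=q^jy_jx_{j+1}$ is extended by $R(s_i^{ -1})=-s_i^{ -1}R(s_i)s_{i+1}^{ -1}$. $\uparrow$ replaces every letter $s_i^{\pm1}$ by $s_{i+1}^{\pm1}$ ($\mathbb{K}[q]$-linearly). AIO rewrites a word by stably sorting its letters according to $x_0<y_0<x_1<y_1<x_2<\cdots$ (a letter $s_i^{ -1}$ ranked as $s_i$), extended linearly. The $q$-derivative is $D(w_1\cdots w_n)=\sum_{j=1}^n\mathrm{AIO}\big(w_1\cdots w_{j-1}R(w_j)\uparrow(w_{j+1}\cdots w_n)\big)$ extended linearly; $D^n$ its iterate. $\phi$ is extended to the $\mathbb{K}[q]$-algebra homomorphism $\mathbb{E}\to\mathbb{K}[q][x^{\pm1},y^{\pm1}]$.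 For $\sigma\in\mathfrak{S}_n$ with $\sigma_0=\sigma_{n+1}=0$, an index $0\le i\le n$ is a descent if $\sigma_i>\sigma_{i+1}$ and an ascent otherwise; $\mathrm{des},\mathrm{asc}$ count them; $\mathrm{inv}(\sigma)=\#\{(i,j):1\le i<j\le n,\ \sigma_i>\sigma_j\}$. -}

module Defs where

open import Level using (Level)
open import Algebra.Bundles using (CommutativeRing)
open import Data.Bool using (Bool; true; false; if_then_else_; _∧_; not)
open import Data.Nat as ℕ using (ℕ; zero; suc; _≤ᵇ_; _<ᵇ_)
open import Data.Integer as ℤ using (ℤ)
open import Data.Fin using (Fin; toℕ)
open import Data.Fin.Properties using () renaming (_≟_ to _≟F_)
open import Data.Vec using (Vec; []; _∷_; toList)
open import Data.List using (List; []; _∷_; _++_; map; concatMap; filter; length; foldr; allFin)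
open import Data.Product using (_×_; _,_)
open import Relation.Nullary using (¬_; does)
open import Relation.Nullary.Decidable using (⌊_⌋)
open import Data.Empty using (⊥)
open import Data.Nat.Properties using () renaming (_≟_ to _≟ℕ_)

data Sym : Set where
  xS yS : Sym

record Letter : Set where
  constructor lt
  field
    sym : Sym
    idx : ℕ
    inverted : Bool
open Letter public

-- Words in the letters s_i^{±1} (representatives of elements of F(S))
Word : Set
Word = List Letter

shiftL : Letter → Letter
shiftL (lt s i e) = lt s (suc i) e

shiftW : Word → Word
shiftW = map shiftL

-- AIO: stable sort by x0 < y0 < x1 < y1 < ...   (s_i^{-1} ranked as s_i)
symRank : Sym → ℕ
symRank xS = 0
symRank yS = 1

key : Letter → ℕ
key l = 2 ℕ.* idx l ℕ.+ symRank (sym l)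

-- stable insertion: an element inserted from the front goes before
-- every element of equal key
insertS : Letter → Word → Word
insertS a [] = a ∷ []
insertS a (b ∷ bs) = if key a ≤ᵇ key b then a ∷ b ∷ bs else b ∷ insertS a bs

AIOw : Word → Word
AIOw [] = []
AIOw (a ∷ as) = insertS a (AIOw as)

module _ {c ℓ : Level} (K : CommutativeRing c ℓ) where
  open CommutativeRing K

  natCast : ℕ → Carrier
  natCast zero = 0#
  natCast (suc n) = 1# + natCast n

  CharZero : Set ℓ
  CharZero = ∀ n → ¬ (natCast (suc n) ≈ 0#)

  -- An element of E = K[q][F(S)], as a finite formal sum of terms
  --   coefficient · q^a · word
  Term : Set c
  Term = Carrier × ℕ × Word

  E : Set c
  E = List Term

  -- the rule R on letters:  R(x_j) = R(y_j) = q^j y_j x_{j+1},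
  -- R(s_j^{-1}) = - s_j^{-1} R(s_j) s_{j+1}^{-1}
  Rl : Letter → E
  Rl (lt s j false) = (1# , j , lt yS j false ∷ lt xS (suc j) false ∷ []) ∷ []
  Rl (lt s j true)  =
    (- 1# , j , lt s j true ∷ lt yS j false ∷ lt xS (suc j) false ∷ lt s (suc j) true ∷ []) ∷ []

  sandwich : Word → E → Word → E
  sandwich u e v = map (λ { (k , a , w) → (k , a , u ++ w ++ v) }) e

  AIOE : E → E
  AIOE = map (λ { (k , a , w) → (k , a , AIOw w) })

  -- D(w_1…w_n) = Σ_j AIO(w_1…w_{j-1} R(w_j) ↑(w_{j+1}…w_n))
  -- (first argument: the already-traversed prefix w_1…w_{j-1})
  Dword′ : Word → Word → E
  Dword′ pre [] = []
  Dword′ pre (l ∷ rest) =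
    AIOE (sandwich pre (Rl l) (shiftW rest)) ++ Dword′ (pre ++ l ∷ []) rest

  Dword : Word → E
  Dword = Dword′ []

  D : E → E
  D = concatMap (λ { (k , a , w) →
        map (λ { (k′ , a′ , w′) → (k * k′ , a ℕ.+ a′ , w′) }) (Dword w) })

  Dⁿ : ℕ → E → E
  Dⁿ zero e = e
  Dⁿ (suc n) e = D (Dⁿ n e)

  x₀ : E
  x₀ = (1# , 0 , lt xS 0 false ∷ []) ∷ []

  -- K[q][x^{±1}, y^{±1}] as finite formal sums of  coefficient · q^a x^b y^c
  Poly : Set c
  Poly = List (Carrier × ℕ × ℤ × ℤ)

  coeff : Poly → ℕ → ℤ → ℤ → Carrier
  coeff [] a b d = 0#
  coeff ((k , a′ , b′ , d′) ∷ p) a b d =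
    (if ⌊ a′ ≟ℕ a ⌋ ∧ ⌊ b′ ℤ.≟ b ⌋ ∧ ⌊ d′ ℤ.≟ d ⌋ then k else 0#) + coeff p a b d

  expL : Letter → ℤ × ℤ
  expL (lt xS _ false) = (ℤ.+ 1 , ℤ.+ 0)
  expL (lt yS _ false) = (ℤ.+ 0 , ℤ.+ 1)
  expL (lt xS _ true)  = (ℤ.- ℤ.+ 1 , ℤ.+ 0)
  expL (lt yS _ true)  = (ℤ.+ 0 , ℤ.- ℤ.+ 1)

  expW : Word → ℤ × ℤ
  expW [] = (ℤ.+ 0 , ℤ.+ 0)
  expW (l ∷ w) with expL l | expW w
  ... | (b , d) | (b′ , d′) = (b ℤ.+ b′ , d ℤ.+ d′)

  φ : E → Poly
  φ = map (λ { (k , a , w) → let (b , d) = expW w in (k , a , b , d) })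

-- The symmetric group S_n: vectors σ = (σ_1,…,σ_n) of elements of Fin n
-- with pairwise distinct entries (value i : Fin n stands for i+1).

allVecs : (n k : ℕ) → List (Vec (Fin n) k)
allVecs n zero = [] ∷ []
allVecs n (suc k) = concatMap (λ i → map (i ∷_) (allVecs n k)) (allFin n)

notIn : {n : ℕ} → Fin n → List (Fin n) → Bool
notIn i [] = true
notIn i (j ∷ js) = not ⌊ i ≟F j ⌋ ∧ notIn i js

distinct : {n : ℕ} → List (Fin n) → Bool
distinct [] = true
distinct (i ∷ is) = notIn i is ∧ distinct is

Sym-n : (n : ℕ) → List (Vec (Fin n) n)
Sym-n n = filter (λ σ → distinct (toList σ) Data.Bool.≟ true) (allVecs n n)

-- σ_0 σ_1 … σ_n σ_{n+1} with σ_0 = σ_{n+1} = 0 and σ_i ∈ {1..n}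
padded : {n : ℕ} → Vec (Fin n) n → List ℕ
padded σ = 0 ∷ map (λ i → suc (toℕ i)) (toList σ) ++ 0 ∷ []

-- descents / ascents over indices 0 ≤ i ≤ n
desL : List ℕ → ℕ
desL [] = 0
desL (a ∷ []) = 0
desL (a ∷ b ∷ r) = (if b <ᵇ a then 1 else 0) ℕ.+ desL (b ∷ r)

ascL : List ℕ → ℕ
ascL [] = 0
ascL (a ∷ []) = 0
ascL (a ∷ b ∷ r) = (if b <ᵇ a then 0 else 1) ℕ.+ ascL (b ∷ r)

des asc : {n : ℕ} → Vec (Fin n) n → ℕ
des σ = desL (padded σ)
asc σ = ascL (padded σ)

invL : List ℕ → ℕ
invL [] = 0
invL (a ∷ r) = length (filter (λ b → b ℕ.<? a) r) ℕ.+ invL r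

inv : {n : ℕ} → Vec (Fin n) n → ℕ
inv σ = invL (map toℕ (toList σ))

Ainv : {c ℓ : Level} (K : CommutativeRing c ℓ) → ℕ → Poly K
Ainv K n = map (λ σ → (CommutativeRing.1# K , inv σ , ℤ.+ asc σ , ℤ.+ des σ)) (Sym-n n)

-- Every term of Dⁿ(x₀) is q^e times a staircase word s₀ s₁ ⋯ sₙ, where sᵢ ∈ {xᵢ, yᵢ}. AIO fixes
-- such words, so D sends one to Σⱼ qʲ times the staircase word with its j-th letter replaced by y x.
-- Encode a permutation σ of {0, …, n-1} by the word of its n+1 slots (x for an ascent, y for a
-- descent) read from the right. Inserting n into σ with j entries after it adds j inversions and
-- replaces slot j by y x. Hence Dⁿ(x₀) is termwise Σ q^inv(σ) w(σ) over the permutations generated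
-- by repeatedly inserting the maximum. That list is a rearrangement of 𝔖ₙ, and φ(w(σ)) = x^asc(σ) y^des(σ).

module Submission where

open import Defs
open import Level using (Level; _⊔_)
open import Algebra.Bundles using (CommutativeRing)
open import Data.Bool as Bool using (true; false; if_then_else_)
open import Data.Fin using (Fin; toℕ; fromℕ<)
import Data.Fin.Properties as Fin
open import Data.Integer as ℤ using (ℤ)
open import Data.List
  using (List; []; _∷_; _++_; [_]; map; length; take; drop; reverse; filter; applyUpTo; concatMap; allFin)
import Data.List.Properties as List
open import Data.List.Membership.Propositional using (_∈_; _∉_; find)
import Data.List.Membership.Propositional.Properties as ∈
open import Data.List.Membership.Propositional.Properties.WithK using (unique∧set⇒bag)
open import Data.List.Relation.Binary.BagAndSetEquality using (∼bag⇒↭)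
open import Data.List.Relation.Binary.Permutation.Propositional
  using (_↭_; prep; swap; ↭-sym; ↭⇒↭ₛ) renaming (refl to ↭-refl; trans to ↭-trans)
import Data.List.Relation.Binary.Permutation.Propositional.Properties as ↭
import Data.List.Relation.Binary.Permutation.Setoid.Properties as ↭ₛ
open import Data.List.Relation.Binary.Pointwise as Pointwise using (Pointwise; []; _∷_)
open import Data.List.Relation.Unary.All as All using (All; []; _∷_)
import Data.List.Relation.Unary.All.Properties as All
open import Data.List.Relation.Unary.Any using (here; there)
open import Data.List.Relation.Unary.AllPairs using ([]; _∷_)
open import Data.List.Relation.Unary.Unique.Propositional using (Unique)
import Data.List.Relation.Unary.Unique.Propositional.Properties as Unique
open import Data.Nat
  using (ℕ; zero; suc; _+_; _*_; _∸_; _≤_; _<_; z≤n; s≤s; s≤s⁻¹; _<ᵇ_; _≤ᵇ_; _<?_; _⊓_)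
import Data.Nat.ListAction.Properties as ℕ
open import Data.Nat.ListAction using (sum)
open import Data.Nat.Properties as ℕ using (module ≤-Reasoning)
open import Data.List.Membership.DecPropositional ℕ._≟_ using (_∈?_)
open import Data.Product using (_×_; _,_; proj₁; proj₂; ∃-syntax)
open import Data.Vec using (Vec; []; _∷_; toList)
import Data.Vec.Properties as Vec
open import Function using (_∘_)
open import Function.Bundles using (mk⇔)
open import Relation.Binary.PropositionalEquality as ≡
  using (_≡_; _≢_; refl; trans; cong; cong₂; subst; module ≡-Reasoning)
open import Relation.Nullary using (¬_; yes; no; contradiction)
open import Relation.Nullary.Reflects using (ofʸ; ofⁿ)

-- Staircase words

staircase : ℕ → List Sym → Word
staircase i []      = []
staircase i (s ∷ w) = lt s i false ∷ staircase (suc i) w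

shiftW-staircase : ∀ i w → shiftW (staircase i w) ≡ staircase (suc i) w
shiftW-staircase i []      = refl
shiftW-staircase i (s ∷ w) = cong (_ ∷_) (shiftW-staircase (suc i) w)

staircase-++ : ∀ i u v → staircase i (u ++ v) ≡ staircase i u ++ staircase (i + length u) v
staircase-++ i []      v = cong (λ k → staircase k v) (≡.sym (ℕ.+-identityʳ i))
staircase-++ i (s ∷ u) v = cong (_ ∷_) (begin
  staircase (suc i) (u ++ v)
    ≡⟨ staircase-++ (suc i) u v ⟩
  staircase (suc i) u ++ staircase (suc i + length u) v
    ≡⟨ cong (λ k → staircase (suc i) u ++ staircase k v) (≡.sym (ℕ.+-suc i (length u))) ⟩
  staircase (suc i) u ++ staircase (i + suc (length u)) v ∎)
  where open ≡-Reasoning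

symRank≤1 : ∀ s → symRank s ≤ 1
symRank≤1 xS = z≤n
symRank≤1 yS = s≤s z≤n

key-staircase-≤ : ∀ s t i → key (lt s i false) ≤ key (lt t (suc i) false)
key-staircase-≤ s t i = begin
  2 * i + symRank s   ≤⟨ ℕ.+-monoʳ-≤ (2 * i) (ℕ.≤-trans (symRank≤1 s) (ℕ.n≤1+n 1)) ⟩
  2 * i + 2           ≡⟨ ℕ.+-comm (2 * i) 2 ⟩
  2 + 2 * i           ≡⟨ ℕ.*-suc 2 i ⟨
  2 * suc i           ≤⟨ ℕ.m≤m+n (2 * suc i) (symRank t) ⟩
  2 * suc i + symRank t ∎
  where open ≤-Reasoning

AIOw-staircase : ∀ i w → AIOw (staircase i w) ≡ staircase i w
AIOw-staircase i []          = refl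
AIOw-staircase i (s ∷ [])    = refl
AIOw-staircase i (s ∷ t ∷ w) rewrite AIOw-staircase (suc i) (t ∷ w)
  with key (lt s i false) ≤ᵇ key (lt t (suc i) false)
     | ℕ.≤ᵇ-reflects-≤ (key (lt s i false)) (key (lt t (suc i) false))
... | true  | _        = refl
... | false | ofⁿ k≰k′ = contradiction (key-staircase-≤ s t i) k≰k′

insertYX : ℕ → List Sym → List Sym
insertYX j       []      = []
insertYX zero    (s ∷ w) = yS ∷ xS ∷ w
insertYX (suc j) (s ∷ w) = s ∷ insertYX j w

insertYX-++ : ∀ u t w → insertYX (length u) (u ++ t ∷ w) ≡ u ++ yS ∷ xS ∷ w
insertYX-++ []      t w = refl
insertYX-++ (s ∷ u) t w = cong (s ∷_) (insertYX-++ u t w)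

applyUpTo⁺ : ∀ {a b r} {A : Set a} {B : Set b} {R : A → B → Set r} {f : ℕ → A} {g : ℕ → B} n →
  (∀ {j} → j < n → R (f j) (g j)) → Pointwise R (applyUpTo f n) (applyUpTo g n)
applyUpTo⁺ zero    Rfg = []
applyUpTo⁺ (suc n) Rfg = Rfg (s≤s z≤n) ∷ applyUpTo⁺ n (Rfg ∘ s≤s)

module _ {c ℓ : Level} (K : CommutativeRing c ℓ) where
  open CommutativeRing K using (1#)

  Dword′-staircase : ∀ u v {m} → m ≡ length u →
    Dword′ K (staircase 0 u) (staircase m v) ≡
    applyUpTo (λ j → (1# , m + j , staircase 0 (u ++ insertYX j v))) (length v)
  Dword′-staircase u []      _    = refl
  Dword′-staircase u (s ∷ v) refl =
    cong₂ _∷_ (cong₂ (λ a w → 1# , a , w) (≡.sym (ℕ.+-identityʳ m)) summand₀) remaining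
    where
    open ≡-Reasoning
    m = length u
    summand₀ : AIOw (staircase 0 u ++ lt yS m false ∷ lt xS (suc m) false ∷ shiftW (staircase (suc m) v))
          ≡ staircase 0 (u ++ yS ∷ xS ∷ v)
    summand₀ = begin
      AIOw (staircase 0 u ++ lt yS m false ∷ lt xS (suc m) false ∷ shiftW (staircase (suc m) v))
        ≡⟨ cong (λ w → AIOw (staircase 0 u ++ lt yS m false ∷ lt xS (suc m) false ∷ w))
                (shiftW-staircase (suc m) v) ⟩
      AIOw (staircase 0 u ++ staircase m (yS ∷ xS ∷ v))
        ≡⟨ cong AIOw (staircase-++ 0 u (yS ∷ xS ∷ v)) ⟨
      AIOw (staircase 0 (u ++ yS ∷ xS ∷ v))
        ≡⟨ AIOw-staircase 0 (u ++ yS ∷ xS ∷ v) ⟩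
      staircase 0 (u ++ yS ∷ xS ∷ v) ∎
    remaining : Dword′ K (staircase 0 u ++ lt s m false ∷ []) (staircase (suc m) v)
         ≡ applyUpTo (λ j → (1# , m + suc j , staircase 0 (u ++ s ∷ insertYX j v))) (length v)
    remaining = begin
      Dword′ K (staircase 0 u ++ lt s m false ∷ []) (staircase (suc m) v)
        ≡⟨ cong (λ w → Dword′ K w (staircase (suc m) v)) (staircase-++ 0 u [ s ]) ⟨
      Dword′ K (staircase 0 (u ++ [ s ])) (staircase (suc m) v)
        ≡⟨ Dword′-staircase (u ++ [ s ]) v (trans (ℕ.+-comm 1 m) (≡.sym (List.length-++ u))) ⟩
      applyUpTo (λ j → (1# , suc m + j , staircase 0 ((u ++ [ s ]) ++ insertYX j v))) (length v)
        ≡⟨ Pointwise.Pointwise-≡⇒≡ (applyUpTo⁺ (length v) λ {j} _ →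
             cong₂ (λ a w → 1# , a , staircase 0 w)
                   (≡.sym (ℕ.+-suc m j)) (List.++-assoc u [ s ] (insertYX j v))) ⟩
      applyUpTo (λ j → (1# , m + suc j , staircase 0 (u ++ s ∷ insertYX j v))) (length v) ∎

  Dword-staircase : ∀ w →
    Dword K (staircase 0 w) ≡ applyUpTo (λ j → (1# , j , staircase 0 (insertYX j w))) (length w)
  Dword-staircase w = Dword′-staircase [] w refl

-- Permutations in one-line notation, generated by inserting the maximum

IsPermutation : ℕ → List ℕ → Set
IsPermutation n p = length p ≡ n × All (_< n) p × Unique p

splice : ℕ → ℕ → List ℕ → List ℕ
splice k m p = take k p ++ m ∷ drop k p

-- The j-th extension of a permutation p of length n places n with exactly j entries of p after it.
extensions : ℕ → List ℕ → List (List ℕ)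
extensions n p = applyUpTo (λ j → splice (n ∸ j) n p) (suc n)

perms : ℕ → List (List ℕ)
perms zero    = [] ∷ []
perms (suc n) = concatMap (extensions n) (perms n)

splice-↭ : ∀ k m p → splice k m p ↭ m ∷ p
splice-↭ k m p = subst (λ q → splice k m p ↭ m ∷ q) (List.take++drop≡id k p) (↭.shift m (take k p) (drop k p))

splice-++ : ∀ m u v → splice (length u) m (u ++ v) ≡ u ++ m ∷ v
splice-++ m []      v = refl
splice-++ m (a ∷ u) v = cong (a ∷_) (splice-++ m u v)

Unique-resp-↭ : ∀ {a} {A : Set a} {xs ys : List A} → xs ↭ ys → Unique xs → Unique ys
Unique-resp-↭ = ↭ₛ.Unique-resp-↭ (≡.setoid _) ∘ ↭⇒↭ₛ

All<suc⇒All< : ∀ {n p} → All (n ≢_) p → All (_< suc n) p → All (_< n) p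
All<suc⇒All< n≢p p<1+n = All.zipWith (λ (n≢x , x<1+n) → ℕ.≤∧≢⇒< (s≤s⁻¹ x<1+n) (n≢x ∘ ≡.sym)) (n≢p , p<1+n)

IsPermutation-splice : ∀ {n p} k → IsPermutation n p → IsPermutation (suc n) (splice k n p)
IsPermutation-splice {n} {p} k (length≡n , p<n , p-unique) =
  trans (↭.↭-length insert) (cong suc length≡n) ,
  ↭.All-resp-↭ (↭-sym insert) (ℕ.≤-refl ∷ All.map ℕ.m≤n⇒m≤1+n p<n) ,
  Unique-resp-↭ (↭-sym insert) (All.map (λ x<n n≡x → ℕ.<-irrefl (≡.sym n≡x) x<n) p<n ∷ p-unique)
  where insert = splice-↭ k n p

perms-sound : ∀ n → All (IsPermutation n) (perms n)
perms-sound zero    = (refl , [] , []) ∷ []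
perms-sound (suc n) = All.concat⁺ (All.map⁺ (All.map
  (λ perm → All.applyUpTo⁺₁ (λ j → splice (n ∸ j) n _) (suc n) (λ _ → IsPermutation-splice _ perm))
  (perms-sound n)))

delete-max : ∀ {m} u v → Unique (u ++ m ∷ v) → All (_< suc m) (u ++ m ∷ v) →
  Unique (u ++ v) × All (_< m) (u ++ v)
delete-max {m} u v unique bounded
  with Unique-resp-↭ (↭.shift m u v) unique | ↭.All-resp-↭ (↭.shift m u v) bounded
... | m≢uv ∷ uv-unique | _ ∷ uv<1+m = uv-unique , All<suc⇒All< m≢uv uv<1+m

Unique∧All<⇒length≤ : ∀ m {p} → Unique p → All (_< m) p → length p ≤ m
Unique∧All<⇒length≤ zero    {[]}    _      _        = z≤n
Unique∧All<⇒length≤ zero    {_ ∷ _} _      (() ∷ _)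
Unique∧All<⇒length≤ (suc m) {p}     unique bounded with m ∈? p
... | no m∉p = ℕ.m≤n⇒m≤1+n (Unique∧All<⇒length≤ m unique (All<suc⇒All< (All.¬Any⇒All¬ p m∉p) bounded))
... | yes m∈p with u , v , refl ← ∈.∈-∃++ m∈p =
  let uv-unique , uv<m = delete-max u v unique bounded in
  subst (_≤ suc m) (≡.sym (↭.↭-length (↭.shift m u v))) (s≤s (Unique∧All<⇒length≤ m uv-unique uv<m))

IsPermutation-delete-max : ∀ {n} u v → IsPermutation (suc n) (u ++ n ∷ v) → IsPermutation n (u ++ v)
IsPermutation-delete-max {n} u v (length≡1+n , bounded , unique) =
  let uv-unique , uv<n = delete-max u v unique bounded in
  ℕ.suc-injective (trans (≡.sym (↭.↭-length (↭.shift n u v))) length≡1+n) , uv<n , uv-unique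

∈-extensions : ∀ {n} u v → length (u ++ v) ≡ n → u ++ n ∷ v ∈ extensions n (u ++ v)
∈-extensions {n} u v length≡n = subst (_∈ extensions n (u ++ v))
  (trans (cong (λ k → splice k n (u ++ v)) (ℕ.m∸[m∸n]≡n u≤n)) (splice-++ n u v))
  (∈.∈-applyUpTo⁺ (λ j → splice (n ∸ j) n (u ++ v)) (s≤s (ℕ.m∸n≤m n (length u))))
  where u≤n = ℕ.≤-trans (List.length-++-≤ˡ u) (ℕ.≤-reflexive length≡n)

perms-complete : ∀ n {p} → IsPermutation n p → p ∈ perms n
perms-complete zero    {[]}    _        = here refl
perms-complete zero    {_ ∷ _} (() , _)
perms-complete (suc n) {p} perm@(length≡1+n , bounded , unique) with n ∈? p
... | no n∉p = contradiction
  (Unique∧All<⇒length≤ n unique (All<suc⇒All< (All.¬Any⇒All¬ p n∉p) bounded))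
  (ℕ.<⇒≱ (ℕ.≤-reflexive (≡.sym length≡1+n)))
... | yes n∈p with u , v , refl ← ∈.∈-∃++ n∈p =
  let perm′ = IsPermutation-delete-max u v perm in
  ∈.∈-concat⁺′ (∈-extensions u v (proj₁ perm′)) (∈.∈-map⁺ (extensions n) (perms-complete n perm′))

++-∷-injective : ∀ {m} u u′ {v v′ : List ℕ} → m ∉ u → m ∉ u′ → u ++ m ∷ v ≡ u′ ++ m ∷ v′ → u ≡ u′ × v ≡ v′
++-∷-injective []      []       _   _    eq = refl , List.∷-injectiveʳ eq
++-∷-injective []      (a ∷ u′) _   m∉u′ eq = contradiction (here (List.∷-injectiveˡ eq)) m∉u′
++-∷-injective (a ∷ u) []       m∉u _    eq = contradiction (here (≡.sym (List.∷-injectiveˡ eq))) m∉u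
++-∷-injective (a ∷ u) (a′ ∷ u′) m∉u m∉u′ eq with refl , eq′ ← List.∷-injective eq
  with refl , refl ← ++-∷-injective u u′ (m∉u ∘ there) (m∉u′ ∘ there) eq′ = refl , refl

∉-take : ∀ {m} k {p : List ℕ} → m ∉ p → m ∉ take k p
∉-take k {p} m∉p = m∉p ∘ subst (_ ∈_) (List.take++drop≡id k p) ∘ ∈.∈-++⁺ˡ

splice-injective : ∀ {m k k′} {p p′ : List ℕ} → m ∉ p → m ∉ p′ → k ≤ length p → k′ ≤ length p′ →
  splice k m p ≡ splice k′ m p′ → k ≡ k′ × p ≡ p′
splice-injective {m} {k} {k′} {p} {p′} m∉p m∉p′ k≤p k′≤p′ eq = k≡k′ , p≡p′
  where
  open ≡-Reasoning
  halves = ++-∷-injective (take k p) (take k′ p′) (∉-take k m∉p) (∉-take k′ m∉p′) eq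
  k≡k′ = begin
    k                        ≡⟨ ℕ.m≤n⇒m⊓n≡m k≤p ⟨
    k ⊓ length p           ≡⟨ List.length-take k p ⟨
    length (take k p)        ≡⟨ cong length (proj₁ halves) ⟩
    length (take k′ p′)      ≡⟨ List.length-take k′ p′ ⟩
    k′ ⊓ length p′         ≡⟨ ℕ.m≤n⇒m⊓n≡m k′≤p′ ⟩
    k′                       ∎
  p≡p′ = begin
    p                        ≡⟨ List.take++drop≡id k p ⟨
    take k p ++ drop k p     ≡⟨ cong₂ _++_ (proj₁ halves) (proj₂ halves) ⟩
    take k′ p′ ++ drop k′ p′ ≡⟨ List.take++drop≡id k′ p′ ⟩
    p′                       ∎

All<⇒∉ : ∀ {n p} → All (_< n) p → n ∉ p
All<⇒∉ p<n n∈p = ℕ.<-irrefl refl (All.lookup p<n n∈p)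

extension-injective : ∀ {n p p′ i j} → IsPermutation n p → IsPermutation n p′ → i ≤ n → j ≤ n →
  splice (n ∸ i) n p ≡ splice (n ∸ j) n p′ → i ≡ j × p ≡ p′
extension-injective {i = i} {j} (refl , p<n , _) (length′ , p′<n , _) i≤n j≤n eq =
  ℕ.∸-cancelˡ-≡ i≤n j≤n (proj₁ splices≡) , proj₂ splices≡
  where
  splices≡ = splice-injective (All<⇒∉ p<n) (All<⇒∉ p′<n)
    (ℕ.m∸n≤m _ i) (ℕ.≤-trans (ℕ.m∸n≤m _ j) (ℕ.≤-reflexive (≡.sym length′))) eq

Unique-concatMap⁺ : ∀ {a b} {A : Set a} {B : Set b} (f : A → List B) {xs} → Unique xs →
  (∀ {x} → x ∈ xs → Unique (f x)) →
  (∀ {x y z} → x ∈ xs → y ∈ xs → z ∈ f x → z ∈ f y → x ≡ y) →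
  Unique (concatMap f xs)
Unique-concatMap⁺ f {[]}     _                _        _        = []
Unique-concatMap⁺ f {x ∷ xs} (x∉xs ∷ unique) unique-f disjoint =
  Unique.++⁺ (unique-f (here refl))
    (Unique-concatMap⁺ f unique (unique-f ∘ there) (λ x∈ y∈ → disjoint (there x∈) (there y∈)))
    separated
  where
  separated : ∀ {z} → ¬ (z ∈ f x × z ∈ concatMap f xs)
  separated (z∈fx , z∈rest) with y , y∈xs , z∈fy ← find (∈.∈-concatMap⁻ f z∈rest) =
    All.lookup x∉xs y∈xs (disjoint (here refl) (there y∈xs) z∈fx z∈fy)

perms-unique : ∀ n → Unique (perms n)
perms-unique zero    = [] ∷ []
perms-unique (suc n) = Unique-concatMap⁺ (extensions n) (perms-unique n) unique-extensions disjoint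
  where
  perm : ∀ {p} → p ∈ perms n → IsPermutation n p
  perm = All.lookup (perms-sound n)
  unique-extensions : ∀ {p} → p ∈ perms n → Unique (extensions n p)
  unique-extensions p∈ = Unique.applyUpTo⁺₁ _ (suc n) λ i<j j<1+n eq →
    ℕ.<⇒≢ i<j (proj₁ (extension-injective (perm p∈) (perm p∈)
      (ℕ.≤-trans (ℕ.<⇒≤ i<j) (s≤s⁻¹ j<1+n)) (s≤s⁻¹ j<1+n) eq))
  disjoint : ∀ {p p′ z} → p ∈ perms n → p′ ∈ perms n → z ∈ extensions n p → z ∈ extensions n p′ → p ≡ p′
  disjoint {p} {p′} p∈ p′∈ z∈ z∈′
    with i , i<1+n , refl ← ∈.∈-applyUpTo⁻ (λ j → splice (n ∸ j) n p) z∈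
       | j , j<1+n , eq   ← ∈.∈-applyUpTo⁻ (λ j → splice (n ∸ j) n p′) z∈′ =
    proj₂ (extension-injective (perm p∈) (perm p′∈) (s≤s⁻¹ i<1+n) (s≤s⁻¹ j<1+n) eq)

-- The enumeration Sym-n

toNats : ∀ {n k} → Vec (Fin n) k → List ℕ
toNats σ = map toℕ (toList σ)

toNats-injective : ∀ {n k} {σ τ : Vec (Fin n) k} → toNats σ ≡ toNats τ → σ ≡ τ
toNats-injective {σ = σ} {τ} eq =
  trans (≡.sym (Vec.cast-is-id refl σ))
        (Vec.toList-injective refl σ τ (List.map-injective Fin.toℕ-injective eq))

fromNats : ∀ {n} (p : List ℕ) → All (_< n) p → Vec (Fin n) (length p)
fromNats []      []          = []
fromNats (a ∷ p) (a<n ∷ p<n) = fromℕ< a<n ∷ fromNats p p<n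

toNats-fromNats : ∀ {n} (p : List ℕ) (p<n : All (_< n) p) → toNats (fromNats p p<n) ≡ p
toNats-fromNats []      []          = refl
toNats-fromNats (a ∷ p) (a<n ∷ p<n) = cong₂ _∷_ (Fin.toℕ-fromℕ< a<n) (toNats-fromNats p p<n)

notIn≡true⇒All≢ : ∀ {n} (i : Fin n) js → notIn i js ≡ true → All (i ≢_) js
notIn≡true⇒All≢ i []       _  = []
notIn≡true⇒All≢ i (j ∷ js) eq with i Fin.≟ j
... | no i≢j = i≢j ∷ notIn≡true⇒All≢ i js eq

All≢⇒notIn≡true : ∀ {n} (i : Fin n) js → All (i ≢_) js → notIn i js ≡ true
All≢⇒notIn≡true i []       _            = refl
All≢⇒notIn≡true i (j ∷ js) (i≢j ∷ i≢js) with i Fin.≟ j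
... | yes i≡j = contradiction i≡j i≢j
... | no _    = All≢⇒notIn≡true i js i≢js

distinct≡true⇒Unique : ∀ {n} (is : List (Fin n)) → distinct is ≡ true → Unique is
distinct≡true⇒Unique []       _  = []
distinct≡true⇒Unique (i ∷ is) eq with notIn i is in head
... | true = notIn≡true⇒All≢ i is head ∷ distinct≡true⇒Unique is eq

Unique⇒distinct≡true : ∀ {n} (is : List (Fin n)) → Unique is → distinct is ≡ true
Unique⇒distinct≡true []       _                = refl
Unique⇒distinct≡true (i ∷ is) (i∉is ∷ unique)
  rewrite All≢⇒notIn≡true i is i∉is = Unique⇒distinct≡true is unique

allVecs-complete : ∀ n k (σ : Vec (Fin n) k) → σ ∈ allVecs n k
allVecs-complete n zero    []      = here refl
allVecs-complete n (suc k) (i ∷ σ) = ∈.∈-concat⁺′ (∈.∈-map⁺ (i ∷_) (allVecs-complete n k σ))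
  (∈.∈-map⁺ (λ i → map (i ∷_) (allVecs n k)) (∈.∈-allFin i))

allVecs-unique : ∀ n k → Unique (allVecs n k)
allVecs-unique n zero    = [] ∷ []
allVecs-unique n (suc k) = Unique-concatMap⁺ (λ i → map (i ∷_) (allVecs n k)) (Unique.allFin⁺ n)
  (λ _ → Unique.map⁺ Vec.∷-injectiveʳ (allVecs-unique n k)) same-head
  where
  same-head : ∀ {i j σ} → i ∈ allFin n → j ∈ allFin n →
    σ ∈ map (i ∷_) (allVecs n k) → σ ∈ map (j ∷_) (allVecs n k) → i ≡ j
  same-head _ _ σ∈ σ∈′ with _ , _ , refl ← ∈.∈-map⁻ _ σ∈ | _ , _ , eq ← ∈.∈-map⁻ _ σ∈′ = Vec.∷-injectiveˡ eq

symmetricGroup : ℕ → List (List ℕ)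
symmetricGroup n = map toNats (Sym-n n)

symmetricGroup-unique : ∀ n → Unique (symmetricGroup n)
symmetricGroup-unique n = Unique.map⁺ toNats-injective (Unique.filter⁺ _ (allVecs-unique n n))

∈-symmetricGroup⁻ : ∀ n {p} → p ∈ symmetricGroup n → IsPermutation n p
∈-symmetricGroup⁻ n p∈ with σ , σ∈ , refl ← ∈.∈-map⁻ toNats p∈ =
  length-toNats σ , toNats<n σ , Unique.map⁺ Fin.toℕ-injective (distinct≡true⇒Unique (toList σ) distinct-σ)
  where
  distinct-σ = proj₂ (∈.∈-filter⁻ (λ σ → distinct (toList σ) Bool.≟ true) {xs = allVecs n n} σ∈)
  length-toNats : ∀ {k} (τ : Vec (Fin n) k) → length (toNats τ) ≡ k
  length-toNats []      = refl
  length-toNats (i ∷ τ) = cong suc (length-toNats τ)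
  toNats<n : ∀ {k} (τ : Vec (Fin n) k) → All (_< n) (toNats τ)
  toNats<n []      = []
  toNats<n (i ∷ τ) = Fin.toℕ<n i ∷ toNats<n τ

∈-symmetricGroup⁺ : ∀ n {p} → IsPermutation n p → p ∈ symmetricGroup n
∈-symmetricGroup⁺ _ {p} (refl , p<n , unique) = subst (_∈ symmetricGroup _) (toNats-fromNats p p<n)
  (∈.∈-map⁺ toNats (∈.∈-filter⁺ _ (allVecs-complete _ _ σ)
    (Unique⇒distinct≡true (toList σ) (Unique.map⁻ (subst Unique (≡.sym (toNats-fromNats p p<n)) unique)))))
  where σ = fromNats p p<n

symmetricGroup↭perms : ∀ n → symmetricGroup n ↭ perms n
symmetricGroup↭perms n = ∼bag⇒↭ (unique∧set⇒bag (symmetricGroup-unique n) (perms-unique n)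
  (mk⇔ (perms-complete n ∘ ∈-symmetricGroup⁻ n) (∈-symmetricGroup⁺ n ∘ All.lookup (perms-sound n))))

-- Inversions and the ascent–descent word under insertion of the maximum

invL-insert-max : ∀ {m} u v → All (_< m) u → All (_< m) v → invL (u ++ m ∷ v) ≡ invL (u ++ v) + length v
invL-insert-max {m} [] v _ v<m rewrite List.filter-all (_<? m) v<m = ℕ.+-comm (length v) (invL v)
invL-insert-max {m} (a ∷ u) v (a<m ∷ u<m) v<m = begin
  length (smaller (u ++ m ∷ v)) + invL (u ++ m ∷ v)
    ≡⟨ cong₂ _+_ (cong length skip-m) (invL-insert-max u v u<m v<m) ⟩
  length (smaller (u ++ v)) + (invL (u ++ v) + length v)
    ≡⟨ ℕ.+-assoc (length (smaller (u ++ v))) (invL (u ++ v)) (length v) ⟨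
  length (smaller (u ++ v)) + invL (u ++ v) + length v ∎
  where
  open ≡-Reasoning
  smaller = filter (_<? a)
  skip-m : smaller (u ++ m ∷ v) ≡ smaller (u ++ v)
  skip-m = begin
    smaller (u ++ m ∷ v)        ≡⟨ List.filter-++ (_<? a) u (m ∷ v) ⟩
    smaller u ++ smaller (m ∷ v) ≡⟨ cong (smaller u ++_) (List.filter-reject (_<? a) (ℕ.<-asym a<m)) ⟩
    smaller u ++ smaller v      ≡⟨ List.filter-++ (_<? a) u v ⟨
    smaller (u ++ v)            ∎

slot : ℕ → ℕ → Sym
slot a b = if b <ᵇ a then yS else xS

slots : List ℕ → List Sym
slots []          = []
slots (a ∷ [])    = []
slots (a ∷ b ∷ l) = slot a b ∷ slots (b ∷ l)

frame : List ℕ → List ℕ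
frame p = 0 ∷ map suc p ++ 0 ∷ []

-- Read from the right, so that inserting the maximum with j entries after it replaces letter j by y x.
slotWord : List ℕ → List Sym
slotWord p = reverse (slots (frame p))

slot-ascent : ∀ {a b} → a ≤ b → slot a b ≡ xS
slot-ascent {a} {b} a≤b with b <ᵇ a | ℕ.<ᵇ-reflects-< b a
... | false | _       = refl
... | true  | ofʸ b<a = contradiction a≤b (ℕ.<⇒≱ b<a)

slot-descent : ∀ {a b} → b < a → slot a b ≡ yS
slot-descent {a} {b} b<a with b <ᵇ a | ℕ.<ᵇ-reflects-< b a
... | true  | _        = refl
... | false | ofⁿ b≮a = contradiction b<a b≮a

length-slots-frame : ∀ a p → length (slots (a ∷ map suc p ++ 0 ∷ [])) ≡ suc (length p)
length-slots-frame a []      = refl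
length-slots-frame a (b ∷ p) = cong suc (length-slots-frame (suc b) p)

slots-insert-max : ∀ {n} a u v → a ≤ n → All (_< n) u → All (_< n) v →
  ∃[ s ] ∃[ t ] ∃[ s′ ] length s′ ≡ length v
    × slots (a ∷ map suc (u ++ v) ++ 0 ∷ []) ≡ s ++ t ∷ s′
    × slots (a ∷ map suc (u ++ n ∷ v) ++ 0 ∷ []) ≡ s ++ xS ∷ yS ∷ s′
slots-insert-max {n} a [] [] a≤n _ _ =
  [] , slot a 0 , [] , refl , refl ,
  cong₂ (λ x y → x ∷ y ∷ []) (slot-ascent (ℕ.m≤n⇒m≤1+n a≤n)) (slot-descent {suc n} (s≤s z≤n))
slots-insert-max a [] (b ∷ v) a≤n _ (b<n ∷ _) =
  [] , slot a (suc b) , s′ , length-slots-frame (suc b) v , refl ,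
  cong₂ (λ x y → x ∷ y ∷ s′) (slot-ascent (ℕ.m≤n⇒m≤1+n a≤n)) (slot-descent (s≤s b<n))
  where s′ = slots (suc b ∷ map suc v ++ 0 ∷ [])
slots-insert-max a (c ∷ u) v _ (c<n ∷ u<n) v<n
  with s , t , s′ , s′≡v , before , after ← slots-insert-max (suc c) u v c<n u<n v<n =
  slot a (suc c) ∷ s , t , s′ , s′≡v , cong (slot a (suc c) ∷_) before , cong (slot a (suc c) ∷_) after

reverse-++-++ : ∀ {a} {A : Set a} (s m s′ : List A) →
  reverse (s ++ m ++ s′) ≡ reverse s′ ++ reverse m ++ reverse s
reverse-++-++ s m s′ = begin
  reverse (s ++ m ++ s′)                ≡⟨ List.reverse-++ s (m ++ s′) ⟩
  reverse (m ++ s′) ++ reverse s        ≡⟨ cong (_++ reverse s) (List.reverse-++ m s′) ⟩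
  (reverse s′ ++ reverse m) ++ reverse s ≡⟨ List.++-assoc (reverse s′) (reverse m) (reverse s) ⟩
  reverse s′ ++ reverse m ++ reverse s  ∎
  where open ≡-Reasoning

slotWord-insert-max : ∀ {n} u v → All (_< n) u → All (_< n) v →
  slotWord (u ++ n ∷ v) ≡ insertYX (length v) (slotWord (u ++ v))
slotWord-insert-max u v u<n v<n
  with s , t , s′ , s′≡v , before , after ← slots-insert-max 0 u v z≤n u<n v<n = begin
  reverse (slots (frame (u ++ _ ∷ v)))                ≡⟨ cong reverse after ⟩
  reverse (s ++ (xS ∷ yS ∷ []) ++ s′)                 ≡⟨ reverse-++-++ s (xS ∷ yS ∷ []) s′ ⟩
  reverse s′ ++ yS ∷ xS ∷ reverse s                   ≡⟨ insertYX-++ (reverse s′) t (reverse s) ⟨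
  insertYX (length (reverse s′)) (reverse s′ ++ t ∷ reverse s)
    ≡⟨ cong₂ insertYX (trans (List.length-reverse s′) s′≡v) (≡.sym (reverse-++-++ s [ t ] s′)) ⟩
  insertYX (length v) (reverse (s ++ [ t ] ++ s′))   ≡⟨ cong (insertYX (length v) ∘ reverse) before ⟨
  insertYX (length v) (slotWord (u ++ v))             ∎
  where open ≡-Reasoning

length-slotWord : ∀ p → length (slotWord p) ≡ suc (length p)
length-slotWord p = trans (List.length-reverse (slots (frame p))) (length-slots-frame 0 p)

module _ {n p j} (perm : IsPermutation n p) (j≤n : j ≤ n) where
  private
    k = n ∸ j
    length≡n = proj₁ perm
    p<n = proj₁ (proj₂ perm)
    take++drop : take k p ++ drop k p ≡ p
    take++drop = List.take++drop≡id k p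
    bounded = All.++⁻ (take k p) (subst (All (_< n)) (≡.sym take++drop) p<n)
    length-drop : length (drop k p) ≡ j
    length-drop = trans (List.length-drop k p) (trans (cong (_∸ k) length≡n) (ℕ.m∸[m∸n]≡n j≤n))

  invL-extension : invL (splice (n ∸ j) n p) ≡ invL p + j
  invL-extension = trans (invL-insert-max (take k p) (drop k p) (proj₁ bounded) (proj₂ bounded))
    (cong₂ _+_ (cong invL take++drop) length-drop)

  slotWord-extension : slotWord (splice (n ∸ j) n p) ≡ insertYX j (slotWord p)
  slotWord-extension = trans (slotWord-insert-max (take k p) (drop k p) (proj₁ bounded) (proj₂ bounded))
    (cong₂ insertYX length-drop (cong slotWord take++drop))

exponentˣ exponentʸ : Sym → ℕ
exponentˣ xS = 1
exponentˣ yS = 0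
exponentʸ xS = 0
exponentʸ yS = 1

sum-map-reverse : ∀ (f : Sym → ℕ) w → sum (map f (reverse w)) ≡ sum (map f w)
sum-map-reverse f w = ℕ.sum-↭ (↭.map⁺ f (↭.↭-reverse w))

ascL-slots : ∀ l → ascL l ≡ sum (map exponentˣ (slots l))
ascL-slots []          = refl
ascL-slots (a ∷ [])    = refl
ascL-slots (a ∷ b ∷ l) with b <ᵇ a | ascL-slots (b ∷ l)
... | true  | ih = ih
... | false | ih = cong suc ih

desL-slots : ∀ l → desL l ≡ sum (map exponentʸ (slots l))
desL-slots []          = refl
desL-slots (a ∷ [])    = refl
desL-slots (a ∷ b ∷ l) with b <ᵇ a | desL-slots (b ∷ l)
... | true  | ih = cong suc ih
... | false | ih = ih

module _ {c ℓ : Level} (K : CommutativeRing c ℓ) where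
  open CommutativeRing K using (Carrier; _≈_; 1#; 0#; +-cong; +-assoc; +-comm; *-cong; *-identityʳ)
    renaming (_*_ to _*ᴷ_; refl to ≈-refl; sym to ≈-sym; trans to ≈-trans)

  term : List ℕ → Term K
  term p = (1# , invL p , staircase 0 (slotWord p))

  monomial : List ℕ → Carrier × ℕ × ℤ × ℤ
  monomial p = (1# , invL p , ℤ.+ ascL (frame p) , ℤ.+ desL (frame p))

  -- Definitionally the map that D applies to Dword w for a term (k , a , w).
  scaleTerm : Carrier → ℕ → Term K → Term K
  scaleTerm k a (k′ , a′ , w′) = (k *ᴷ k′ , a + a′ , w′)

  _≈ᵗ_ : Term K → Term K → Set ℓ
  t ≈ᵗ t′ = proj₁ t ≈ proj₁ t′ × proj₂ t ≡ proj₂ t′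

  _≋_ : E K → E K → Set (c ⊔ ℓ)
  _≋_ = Pointwise _≈ᵗ_

  ≋-trans : ∀ {e e′ e″} → e ≋ e′ → e′ ≋ e″ → e ≋ e″
  ≋-trans = Pointwise.transitive (λ (k≈k′ , eq) (k′≈k″ , eq′) → ≈-trans k≈k′ k′≈k″ , trans eq eq′)

  scaleTerm-cong : ∀ {k k′} a w → k ≈ k′ → map (scaleTerm k a) (Dword K w) ≋ map (scaleTerm k′ a) (Dword K w)
  scaleTerm-cong a w k≈k′ = Pointwise.map⁺ _ _ (Pointwise.refl (*-cong k≈k′ ≈-refl , refl))

  D-cong : ∀ {e e′} → e ≋ e′ → D K e ≋ D K e′
  D-cong []                                  = []
  D-cong {(_ , a , w) ∷ _} ((k≈k′ , refl) ∷ e≋e′) = Pointwise.++⁺ (scaleTerm-cong a w k≈k′) (D-cong e≋e′)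

  D-term : ∀ {n p} → IsPermutation n p →
    map (scaleTerm 1# (invL p)) (Dword K (staircase 0 (slotWord p))) ≋ map term (extensions n p)
  D-term {n} {p} perm =
    ≡.subst₂ _≋_ (≡.sym derivative) (≡.sym (List.map-applyUpTo (λ j → splice (n ∸ j) n p) term (suc n)))
    (applyUpTo⁺ (suc n) λ j<1+n → *-identityʳ 1# ,
      cong₂ _,_ (≡.sym (invL-extension perm (s≤s⁻¹ j<1+n)))
                (cong (staircase 0) (≡.sym (slotWord-extension perm (s≤s⁻¹ j<1+n)))))
    where
    open ≡-Reasoning
    derivative : map (scaleTerm 1# (invL p)) (Dword K (staircase 0 (slotWord p)))
               ≡ applyUpTo (λ j → (1# *ᴷ 1# , invL p + j , staircase 0 (insertYX j (slotWord p)))) (suc n)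
    derivative = begin
      map (scaleTerm 1# (invL p)) (Dword K (staircase 0 (slotWord p)))
        ≡⟨ cong (map (scaleTerm 1# (invL p))) (Dword-staircase K (slotWord p)) ⟩
      map (scaleTerm 1# (invL p))
          (applyUpTo (λ j → (1# , j , staircase 0 (insertYX j (slotWord p)))) (length (slotWord p)))
        ≡⟨ List.map-applyUpTo _ (scaleTerm 1# (invL p)) (length (slotWord p)) ⟩
      applyUpTo (λ j → (1# *ᴷ 1# , invL p + j , staircase 0 (insertYX j (slotWord p)))) (length (slotWord p))
        ≡⟨ cong (applyUpTo _) (trans (length-slotWord p) (cong suc (proj₁ perm))) ⟩
      applyUpTo (λ j → (1# *ᴷ 1# , invL p + j , staircase 0 (insertYX j (slotWord p)))) (suc n) ∎

  D-terms : ∀ {n ps} → All (IsPermutation n) ps → D K (map term ps) ≋ map term (concatMap (extensions n) ps)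
  D-terms []                             = []
  D-terms {n} {p ∷ ps} (perm ∷ perms) =
    subst (D K (map term (p ∷ ps)) ≋_) (≡.sym (List.map-++ term (extensions n p) (concatMap (extensions n) ps)))
      (Pointwise.++⁺ (D-term perm) (D-terms perms))

  Dⁿx₀≋terms : ∀ n → Dⁿ K n (x₀ K) ≋ map term (perms n)
  Dⁿx₀≋terms zero    = (≈-refl , refl) ∷ []
  Dⁿx₀≋terms (suc n) = ≋-trans (D-cong (Dⁿx₀≋terms n)) (D-terms (perms-sound n))

  if-then-else-0-cong : ∀ c {k k′} → k ≈ k′ → (if c then k else 0#) ≈ (if c then k′ else 0#)
  if-then-else-0-cong true  k≈k′ = k≈k′
  if-then-else-0-cong false _    = ≈-refl

  coeff-φ-cong : ∀ {e e′} → e ≋ e′ → ∀ a b d → coeff K (φ K e) a b d ≈ coeff K (φ K e′) a b d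
  coeff-φ-cong []                                      a b d = ≈-refl
  coeff-φ-cong {(_ , _ , w) ∷ _} ((k≈k′ , refl) ∷ e≋e′) a b d =
    +-cong (if-then-else-0-cong _ k≈k′) (coeff-φ-cong e≋e′ a b d)

  coeff-↭ : ∀ {P Q} → P ↭ Q → ∀ a b d → coeff K P a b d ≈ coeff K Q a b d
  coeff-↭ ↭-refl        a b d = ≈-refl
  coeff-↭ (prep _ P↭Q)  a b d = +-cong ≈-refl (coeff-↭ P↭Q a b d)
  coeff-↭ (swap _ _ P↭Q) a b d =
    ≈-trans (≈-sym (+-assoc _ _ _)) (≈-trans (+-cong (+-comm _ _) (coeff-↭ P↭Q a b d)) (+-assoc _ _ _))
  coeff-↭ (↭-trans P↭Q Q↭R) a b d = ≈-trans (coeff-↭ P↭Q a b d) (coeff-↭ Q↭R a b d)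

  expW-staircase : ∀ i w → expW K (staircase i w) ≡ (ℤ.+ sum (map exponentˣ w) , ℤ.+ sum (map exponentʸ w))
  expW-staircase i []       = refl
  expW-staircase i (xS ∷ w) rewrite expW-staircase (suc i) w = refl
  expW-staircase i (yS ∷ w) rewrite expW-staircase (suc i) w = refl

  expW-slotWord : ∀ p → expW K (staircase 0 (slotWord p)) ≡ (ℤ.+ ascL (frame p) , ℤ.+ desL (frame p))
  expW-slotWord p = trans (expW-staircase 0 (slotWord p)) (cong₂ (λ b d → ℤ.+ b , ℤ.+ d)
    (trans (sum-map-reverse exponentˣ (slots (frame p))) (≡.sym (ascL-slots (frame p))))
    (trans (sum-map-reverse exponentʸ (slots (frame p))) (≡.sym (desL-slots (frame p)))))

  φ-terms : ∀ ps → φ K (map term ps) ≡ map monomial ps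
  φ-terms []       = refl
  φ-terms (p ∷ ps) = cong₂ _∷_ (cong (λ (b , d) → 1# , invL p , b , d) (expW-slotWord p)) (φ-terms ps)

  Ainv≡monomials : ∀ n → Ainv K n ≡ map monomial (symmetricGroup n)
  Ainv≡monomials n = trans (List.map-cong monomial-toNats (Sym-n n)) (List.map-∘ (Sym-n n))
    where
    monomial-toNats : ∀ σ → (1# , inv σ , ℤ.+ asc σ , ℤ.+ des σ) ≡ monomial (toNats σ)
    monomial-toNats σ rewrite List.map-∘ {g = suc} {f = toℕ} (toList σ) = refl

theorem5p4 : {c ℓ : Level} (K : CommutativeRing c ℓ) → CharZero K →
    (n : ℕ) → 1 ≤ n → (a : ℕ) (b d : ℤ) →
    CommutativeRing._≈_ K (coeff K (φ K (Dⁿ K n (x₀ K))) a b d) (coeff K (Ainv K n) a b d)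
theorem5p4 K _ n _ a b d = begin
  coeff K (φ K (Dⁿ K n (x₀ K))) a b d
    ≈⟨ coeff-φ-cong K (Dⁿx₀≋terms K n) a b d ⟩
  coeff K (φ K (map (term K) (perms n))) a b d
    ≡⟨ cong (λ P → coeff K P a b d) (φ-terms K (perms n)) ⟩
  coeff K (map (monomial K) (perms n)) a b d
    ≈⟨ coeff-↭ K (↭.map⁺ (monomial K) (↭-sym (symmetricGroup↭perms n))) a b d ⟩
  coeff K (map (monomial K) (symmetricGroup n)) a b d
    ≡⟨ cong (λ P → coeff K P a b d) (Ainv≡monomials K n) ⟨
  coeff K (Ainv K n) a b d ∎
  where open import Relation.Binary.Reasoning.Setoid (CommutativeRing.setoid K)
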